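{- Let $E/\mathbb{Q}$ be an elliptic curve with minimal signature $(c_4,c_6,\Delta)$, and let $a_1\in\{0,1\}$ with $a_1\equiv c_6\pmod 2$. Then $\operatorname{rmm}(E)=R_i$ where $i$ is determined by the residue of $2^{a_1-1}c_6$ modulo $24$ as follows: residue $0\mapsto i=1$, $12\mapsto 2$, $8\mapsto3$, $20\mapsto4$, $16\mapsto5$, $4\mapsto6$, $23\mapsto7$, $11\mapsto8$, $3\mapsto9$, $15\mapsto10$, $19\mapsto11$, $7\mapsto12$. Moreover, writing $R_i=(a_1,a_2,a_3)$, the reduced minimal model of $E$ is $y^2+a_1xy+a_3y=x^3+a_2x^2-\frac{A_i}{48}x-\frac{B_i}{1728}$, where $(A_1,B_1)=(c_4,2c_6)$, $(A_2,B_2)=(c_4,2(c_6+216))$, $(A_3,B_3)=(c_4-16,2(-6c_4+c_6+32))$, $(A_4,B_4)=(c_4-16,2(-6c_4+c_6+248))$, $(A_5,B_5)=(c_4-16,2(6c_4+c_6-32))$, $(A_6,B_6)=(c_4-16,2(6c_4+c_6+184))$, $(A_7,B_7)=(c_4-1,3c_4+2c_6-1)$, $(A_8,B_8)=(c_4+23,3c_4+2c_6+431)$, $(A_9,B_9)=(c_4-9,-9c_4+2c_6+27)$, $(A_{10},B_{10})=(c_4+15,-9c_4+2c_6+459)$, $(A_{11},B_{11})=(c_4-25,15c_4+2c_6-125)$, $(A_{12},B_{12})=(c_4-1,15c_4+2c_6+307)$.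
   Context: For a Weierstrass model $y^2+a_1xy+a_3y=x^3+a_2x^2+a_4x+a_6$ set $c_4=a_1^4+8a_1^2a_2-24a_1a_3+16a_2^2-48a_4$, $c_6=-(a_1^2+4a_2)^3+36(a_1^2+4a_2)(2a_4+a_1a_3)-216(a_3^2+4a_6)$, $\Delta=(c_4^3-c_6^2)/1728$. A global minimal model of $E/\mathbb{Q}$ is an integral Weierstrass model $\mathbb{Q}$-isomorphic to $E$ whose discriminant has minimal absolute value; the minimal signature of $E$ is $(c_4,c_6,\Delta)$ computed from a global minimal model. The reduced minimal model of $E$ is the unique global minimal model with $a_1,a_3\in\{0,1\}$, $a_2\in\{ -1,0,1\}$, and $\operatorname{rmm}(E)=(a_1,a_2,a_3)$ for it. $R_1=(0,0,0)$, $R_2=(0,0,1)$, $R_3=(0,-1,0)$, $R_4=(0,-1,1)$, $R_5=(0,1,0)$, $R_6=(0,1,1)$, $R_7=(1,0,0)$, $R_8=(1,0,1)$, $R_9=(1,-1,0)$, $R_{10}=(1,-1,1)$, $R_{11}=(1,1,0)$, $R_{12}=(1,1,1)$. Note $2^{a_1-1}c_6$ equals $c_6/2$ if $c_6$ is even and $c_6$ if $c_6$ is odd. -}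

module Defs where

open import Data.Integer as ℤ using (ℤ; +_; -[1+_])
import Data.Integer.DivMod as ℤD
open import Data.Nat using (ℕ)
open import Data.Rational using (ℚ; _+_; _*_; _-_; -_; _/_; _≤_; ∣_∣; 0ℚ)
open import Data.Product using (Σ; _×_; _,_; ∃)
open import Data.Sum using (_⊎_)
open import Relation.Binary.PropositionalEquality using (_≡_; _≢_)

record Weierstrass : Set where
  constructor wm
  field
    a₁ a₂ a₃ a₄ a₆ : ℚ
open Weierstrass public

ι : ℤ → ℚ
ι z = z / 1

# : ℕ → ℚ
# n = ι (+ n)

c₄ : Weierstrass → ℚ
c₄ (wm a1 a2 a3 a4 a6) =
  a1 * a1 * a1 * a1 + # 8 * a1 * a1 * a2 - # 24 * a1 * a3 + # 16 * a2 * a2 - # 48 * a4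

c₆ : Weierstrass → ℚ
c₆ (wm a1 a2 a3 a4 a6) =
  - (b * b * b) + # 36 * b * (# 2 * a4 + a1 * a3) - # 216 * (a3 * a3 + # 4 * a6)
  where b = a1 * a1 + # 4 * a2

Δ : Weierstrass → ℚ
Δ W = (c₄ W * c₄ W * c₄ W - c₆ W * c₆ W) * (+ 1 / 1728)

IsEllipticCurve : Weierstrass → Set
IsEllipticCurve W = Δ W ≢ 0ℚ

IsInteger : ℚ → Set
IsInteger q = Σ ℤ λ z → q ≡ ι z

IsIntegral : Weierstrass → Set
IsIntegral W = IsInteger (a₁ W) × IsInteger (a₂ W) × IsInteger (a₃ W)
             × IsInteger (a₄ W) × IsInteger (a₆ W)

-- W' is obtained from W by the change of variables
-- x = u²x' + r, y = u³y' + su²x' + t  (u ≠ 0)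
Transforms : Weierstrass → ℚ → ℚ → ℚ → ℚ → Weierstrass → Set
Transforms (wm a1 a2 a3 a4 a6) u r s t (wm b1 b2 b3 b4 b6) =
  (u ≢ 0ℚ)
  × (u * b1 ≡ a1 + # 2 * s)
  × (u * u * b2 ≡ a2 - s * a1 + # 3 * r - s * s)
  × (u * u * u * b3 ≡ a3 + r * a1 + # 2 * t)
  × (u * u * u * u * b4 ≡ a4 - s * a3 + # 2 * r * a2 - (t + r * s) * a1 + # 3 * r * r - # 2 * s * t)
  × (u * u * u * u * u * u * b6 ≡ a6 + r * a4 + r * r * a2 + r * r * r - t * a3 - t * t - r * t * a1)

_≅_ : Weierstrass → Weierstrass → Set
W ≅ W' = Σ ℚ λ u → Σ ℚ λ r → Σ ℚ λ s → Σ ℚ λ t → Transforms W u r s t W'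

IsGlobalMinimal : Weierstrass → Weierstrass → Set
IsGlobalMinimal E M =
  IsIntegral M × (E ≅ M) × (∀ M' → IsIntegral M' → E ≅ M' → ∣ Δ M ∣ ≤ ∣ Δ M' ∣)

IsMinimalSignature : Weierstrass → ℤ → ℤ → ℤ → Set
IsMinimalSignature E c4 c6 D =
  Σ Weierstrass λ M → IsGlobalMinimal E M × c₄ M ≡ ι c4 × c₆ M ≡ ι c6 × Δ M ≡ ι D

IsReducedForm : Weierstrass → Set
IsReducedForm M =
  (a₁ M ≡ # 0 ⊎ a₁ M ≡ # 1) × (a₃ M ≡ # 0 ⊎ a₃ M ≡ # 1)
  × (a₂ M ≡ - # 1 ⊎ a₂ M ≡ # 0 ⊎ a₂ M ≡ # 1)

IsReducedMinimalModel : Weierstrass → Weierstrass → Set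
IsReducedMinimalModel E M = IsGlobalMinimal E M × IsReducedForm M

data Idx : Set where
  i1 i2 i3 i4 i5 i6 i7 i8 i9 i10 i11 i12 : Idx

R : Idx → ℤ × ℤ × ℤ
R i1  = (+ 0 , + 0 , + 0)
R i2  = (+ 0 , + 0 , + 1)
R i3  = (+ 0 , -[1+ 0 ] , + 0)
R i4  = (+ 0 , -[1+ 0 ] , + 1)
R i5  = (+ 0 , + 1 , + 0)
R i6  = (+ 0 , + 1 , + 1)
R i7  = (+ 1 , + 0 , + 0)
R i8  = (+ 1 , + 0 , + 1)
R i9  = (+ 1 , -[1+ 0 ] , + 0)
R i10 = (+ 1 , -[1+ 0 ] , + 1)
R i11 = (+ 1 , + 1 , + 0)
R i12 = (+ 1 , + 1 , + 1)

data ResidueIndex : ℕ → Idx → Set where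
  r0  : ResidueIndex 0  i1
  r12 : ResidueIndex 12 i2
  r8  : ResidueIndex 8  i3
  r20 : ResidueIndex 20 i4
  r16 : ResidueIndex 16 i5
  r4  : ResidueIndex 4  i6
  r23 : ResidueIndex 23 i7
  r11 : ResidueIndex 11 i8
  r3  : ResidueIndex 3  i9
  r15 : ResidueIndex 15 i10
  r19 : ResidueIndex 19 i11
  r7  : ResidueIndex 7  i12

AB : Idx → ℤ → ℤ → ℤ × ℤ
AB i1  c4 c6 = (c4 , + 2 ℤ.* c6)
AB i2  c4 c6 = (c4 , + 2 ℤ.* (c6 ℤ.+ + 216))
AB i3  c4 c6 = (c4 ℤ.- + 16 , + 2 ℤ.* (ℤ.- (+ 6 ℤ.* c4) ℤ.+ c6 ℤ.+ + 32))
AB i4  c4 c6 = (c4 ℤ.- + 16 , + 2 ℤ.* (ℤ.- (+ 6 ℤ.* c4) ℤ.+ c6 ℤ.+ + 248))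
AB i5  c4 c6 = (c4 ℤ.- + 16 , + 2 ℤ.* (+ 6 ℤ.* c4 ℤ.+ c6 ℤ.- + 32))
AB i6  c4 c6 = (c4 ℤ.- + 16 , + 2 ℤ.* (+ 6 ℤ.* c4 ℤ.+ c6 ℤ.+ + 184))
AB i7  c4 c6 = (c4 ℤ.- + 1 , + 3 ℤ.* c4 ℤ.+ + 2 ℤ.* c6 ℤ.- + 1)
AB i8  c4 c6 = (c4 ℤ.+ + 23 , + 3 ℤ.* c4 ℤ.+ + 2 ℤ.* c6 ℤ.+ + 431)
AB i9  c4 c6 = (c4 ℤ.- + 9 , ℤ.- (+ 9 ℤ.* c4) ℤ.+ + 2 ℤ.* c6 ℤ.+ + 27)
AB i10 c4 c6 = (c4 ℤ.+ + 15 , ℤ.- (+ 9 ℤ.* c4) ℤ.+ + 2 ℤ.* c6 ℤ.+ + 459)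
AB i11 c4 c6 = (c4 ℤ.- + 25 , + 15 ℤ.* c4 ℤ.+ + 2 ℤ.* c6 ℤ.- + 125)
AB i12 c4 c6 = (c4 ℤ.- + 1 , + 15 ℤ.* c4 ℤ.+ + 2 ℤ.* c6 ℤ.+ + 307)

model : Idx → ℤ → ℤ → Weierstrass
model i c4 c6 with R i | AB i c4 c6
... | (x1 , x2 , x3) | (A , B) = wm (ι x1) (ι x2) (ι x3) (- (A / 48)) (- (B / 1728))

-- 2^(a₁-1) c₆ for a₁ ∈ {0,1}: c₆/2 if a₁ = 0, c₆ if a₁ = 1
scaledC6 : ℤ → ℤ → ℤ
scaledC6 (+ 0) c6 = c6 ℤD./ + 2
scaledC6 _     c6 = c6

residue24 : ℤ → ℕ
residue24 z = z ℤD.% + 24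

{-# OPTIONS --safe #-}
-- A translation x ↦ x + r, y ↦ y + s x + t changes a₁ by 2s, a₂ by 3r and a₃ by 2t (up to
-- terms in the previous choices), so every integral model, in particular a global minimal
-- one, translates to a model with a₁, a₃ ∈ {0,1} and a₂ ∈ {-1,0,1}; translations fix c₄, c₆
-- and Δ, so that model is again global minimal. Two global minimal models have the same ∣Δ∣,
-- so their scalings u, v from E satisfy u¹² = v¹², whence u² = v² and they share c₄ and c₆.
-- On each of the twelve shapes (a₁,a₂,a₃), c₄ and c₆ are affine in a₄, a₆ with slopes -48 and
-- -864, which recovers a₄, a₆ from (c₄,c₆) as -A_i/48 and -B_i/1728; moreover c₆ is constant
-- modulo 48 (if a₁ = 0) or 24 (if a₁ = 1) on a shape. That constant fixes the parity of c₆,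
-- hence a₁, and the residue of 2^(a₁-1) c₆ modulo 24, which singles out the shape.

module Submission where

open import Defs
open import Data.Nat as ℕ using (ℕ)
open import Data.Integer as ℤ using (ℤ; +_; -[1+_]; +[1+_])
import Data.Integer.Properties as ℤP
open import Algebra.Properties.Ring ℤP.+-*-ring using (+-cancelʳ)
import Data.Integer.DivMod as ℤD
open import Data.Integer.Divisibility using (_∣_)
import Data.Integer.Divisibility.Signed as Signed
import Data.Integer.Tactic.RingSolver as ℤ-Tactic
open import Data.Nat.Coprimality using (1-coprimeTo) renaming (sym to coprime-sym)
open import Data.Rational as ℚ using (ℚ; mkℚ; ↥_; 0ℚ; _<_; _≤_; ∣_∣; 1/_; positive; negative; ≢-nonZero)
import Data.Rational.Properties as ℚP
import Data.Rational.Unnormalised as ℚᵘ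
open import Data.Fin.Patterns using (0F; 1F; 2F; 3F; 4F; 5F; 6F; 7F)
open import Data.List using ([]; _∷_)
open import Data.Vec as Vec using (Vec)
open import Data.Vec.Properties using (lookup-map)
open import Data.Product using (Σ; _×_; _,_; proj₁; proj₂)
open import Data.Sum as Sum using (_⊎_; inj₁; inj₂)
open import Data.Empty using (⊥; ⊥-elim)
open import Relation.Binary.Definitions using (tri<; tri≈; tri>)
open import Relation.Binary.PropositionalEquality
open import Relation.Nullary.Decidable using (dec⇒maybe)
open import Level using (0ℓ)
open import Algebra.Bundles using (CommutativeRing; RawRing)
import Algebra.Definitions.RawSemiring as RawSemiringDefs
open import Tactic.RingSolver.Core.AlmostCommutativeRing using (AlmostCommutativeRing; fromCommutativeRing)
open import Tactic.RingSolver.Core.Expression using (Expr; Κ; Ι; _⊕_; _⊗_; _⊛_; ⊝_; module Eval)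
import Tactic.RingSolver.NonReflective as NonReflective

fromℤ : ℤ → ℚ
fromℤ z = mkℚ z 0 (coprime-sym (1-coprimeTo _))

ι≡fromℤ : ∀ z → ι z ≡ fromℤ z
ι≡fromℤ z = ℚP.↥p/↧p≡p (fromℤ z)

ι-injective : ∀ {a b} → ι a ≡ ι b → a ≡ b
ι-injective {a} {b} eq = cong ↥_ (trans (sym (ι≡fromℤ a)) (trans eq (ι≡fromℤ b)))

ι-+ : ∀ a b → ι (a ℤ.+ b) ≡ ι a ℚ.+ ι b
ι-+ a b rewrite ι≡fromℤ a | ι≡fromℤ b =
  cong ι (sym (cong₂ ℤ._+_ (ℤP.*-identityʳ a) (ℤP.*-identityʳ b)))

ι-* : ∀ a b → ι (a ℤ.* b) ≡ ι a ℚ.* ι b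
ι-* a b rewrite ι≡fromℤ a | ι≡fromℤ b = refl

ι-neg : ∀ a → ι (ℤ.- a) ≡ ℚ.- ι a
ι-neg a rewrite ι≡fromℤ a | ι≡fromℤ (ℤ.- a) = neg-fromℤ a
  where
  neg-fromℤ : ∀ a → fromℤ (ℤ.- a) ≡ ℚ.- fromℤ a
  neg-fromℤ (+ 0)    = refl
  neg-fromℤ +[1+ n ] = refl
  neg-fromℤ -[1+ n ] = refl

*-/-cancel : ∀ m z → (+ ℕ.suc m ℤ.* z) ℚ./ ℕ.suc m ≡ ι z
*-/-cancel m z = ℚP.fromℚᵘ-cong {ℚᵘ.mkℚᵘ (+ ℕ.suc m ℤ.* z) m} {ℚᵘ.mkℚᵘ z 0}
  (ℚᵘ.*≡* (trans (ℤP.*-identityʳ _) (ℤP.*-comm (+ ℕ.suc m) z)))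

neg-*-/-cancel : ∀ m z → ℚ.- ((+ ℕ.suc m ℤ.* ℤ.- z) ℚ./ ℕ.suc m) ≡ ι z
neg-*-/-cancel m z = begin
  ℚ.- ((+ ℕ.suc m ℤ.* ℤ.- z) ℚ./ ℕ.suc m) ≡⟨ cong ℚ.-_ (*-/-cancel m (ℤ.- z)) ⟩
  ℚ.- ι (ℤ.- z)                          ≡⟨ ι-neg (ℤ.- z) ⟨
  ι (ℤ.- ℤ.- z)                          ≡⟨ cong ι (ℤP.neg-involutive z) ⟩
  ι z                                    ∎
  where open ≡-Reasoning

-- Written over an arbitrary ring, so that the same text gives the ℚ-values (definitionally
-- those of c₄, c₆ and Transforms), the ℤ-values, and the syntax handed to the ring solver.
module WeierstrassFormulas (R : RawRing 0ℓ 0ℓ) (# : ℕ → RawRing.Carrier R) where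

  open RawRing R using (Carrier; _+_; _*_; -_)

  infixl 6 _-_
  _-_ : Carrier → Carrier → Carrier
  x - y = x + - y

  C₄ : (a₁ a₂ a₃ a₄ : Carrier) → Carrier
  C₄ a₁ a₂ a₃ a₄ =
    a₁ * a₁ * a₁ * a₁ + # 8 * a₁ * a₁ * a₂ - # 24 * a₁ * a₃ + # 16 * a₂ * a₂ - # 48 * a₄

  C₆ : (a₁ a₂ a₃ a₄ a₆ : Carrier) → Carrier
  C₆ a₁ a₂ a₃ a₄ a₆ =
    - (b₂ * b₂ * b₂) + # 36 * b₂ * (# 2 * a₄ + a₁ * a₃) - # 216 * (a₃ * a₃ + # 4 * a₆)
    where b₂ = a₁ * a₁ + # 4 * a₂

  -- the coefficients after x ↦ x + r, y ↦ y + s x + t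
  τ₁ : (a₁ s : Carrier) → Carrier
  τ₁ a₁ s = a₁ + # 2 * s

  τ₂ : (a₁ a₂ r s : Carrier) → Carrier
  τ₂ a₁ a₂ r s = a₂ - s * a₁ + # 3 * r - s * s

  τ₃ : (a₁ a₃ r t : Carrier) → Carrier
  τ₃ a₁ a₃ r t = a₃ + r * a₁ + # 2 * t

  τ₄ : (a₁ a₂ a₃ a₄ r s t : Carrier) → Carrier
  τ₄ a₁ a₂ a₃ a₄ r s t =
    a₄ - s * a₃ + # 2 * r * a₂ - (t + r * s) * a₁ + # 3 * r * r - # 2 * s * t

  τ₆ : (a₁ a₂ a₃ a₄ a₆ r t : Carrier) → Carrier
  τ₆ a₁ a₂ a₃ a₄ a₆ r t =
    a₆ + r * a₄ + r * r * a₂ + r * r * r - t * a₃ - t * t - r * t * a₁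

exprRawRing : ∀ {A : Set} (n : ℕ) (lit : ℕ → A) → RawRing 0ℓ 0ℓ
exprRawRing {A} n lit = record
  { Carrier = Expr A n ; _≈_ = _≡_ ; _+_ = _⊕_ ; _*_ = _⊗_ ; -_ = ⊝_
  ; 0# = Κ (lit 0) ; 1# = Κ (lit 1) }

ℚ-rawRing ℤ-rawRing : RawRing 0ℓ 0ℓ
ℚ-rawRing = CommutativeRing.rawRing ℚP.+-*-commutativeRing
ℤ-rawRing = CommutativeRing.rawRing ℤP.+-*-commutativeRing

module ℚʷ = WeierstrassFormulas ℚ-rawRing #
module ℤʷ = WeierstrassFormulas ℤ-rawRing +_
module ℚᵉ {n} = WeierstrassFormulas (exprRawRing n #) (λ k → Κ (# k))
module ℤᵉ {n} = WeierstrassFormulas (exprRawRing n +_) (λ k → Κ (+ k))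

ℚ-ring : AlmostCommutativeRing 0ℓ 0ℓ
ℚ-ring = fromCommutativeRing ℚP.+-*-commutativeRing λ x → dec⇒maybe (0ℚ ℚP.≟ x)

open NonReflective ℚ-ring using () renaming (solve to ℚ-solve)
open NonReflective ℤ-Tactic.ring using () renaming (solve to ℤ-solve)

open RawSemiringDefs (RawRing.rawSemiring ℤ-rawRing) using () renaming (_^′_ to _^ℤ_)
open RawSemiringDefs (RawRing.rawSemiring ℚ-rawRing) using () renaming (_^′_ to _^ℚ_)
open Eval ℤ-rawRing (λ z → z) renaming (⟦_⟧ to ⟦_⟧ℤ)
open Eval ℚ-rawRing ι renaming (⟦_⟧ to ⟦_⟧ℚ)

ι-⟦⟧ : ∀ {n} (e : Expr ℤ n) (ρ : Vec ℤ n) → ⟦ e ⟧ℚ (Vec.map ι ρ) ≡ ι (⟦ e ⟧ℤ ρ)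
ι-⟦⟧ (Κ z)   ρ = refl
ι-⟦⟧ (Ι i)   ρ = lookup-map i ι ρ
ι-⟦⟧ (e ⊕ f) ρ = trans (cong₂ ℚ._+_ (ι-⟦⟧ e ρ) (ι-⟦⟧ f ρ)) (sym (ι-+ (⟦ e ⟧ℤ ρ) (⟦ f ⟧ℤ ρ)))
ι-⟦⟧ (e ⊗ f) ρ = trans (cong₂ ℚ._*_ (ι-⟦⟧ e ρ) (ι-⟦⟧ f ρ)) (sym (ι-* (⟦ e ⟧ℤ ρ) (⟦ f ⟧ℤ ρ)))
ι-⟦⟧ (⊝ e)   ρ = trans (cong ℚ.-_ (ι-⟦⟧ e ρ)) (sym (ι-neg (⟦ e ⟧ℤ ρ)))
ι-⟦⟧ (e ⊛ k) ρ = trans (cong (_^ℚ k) (ι-⟦⟧ e ρ)) (ι-^ (⟦ e ⟧ℤ ρ) k)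
  where
  ι-^ : ∀ z k → ι z ^ℚ k ≡ ι (z ^ℤ k)
  ι-^ z 0 = refl
  ι-^ z 1 = refl
  ι-^ z (ℕ.suc (ℕ.suc k)) = trans (cong (ℚ._* ι z) (ι-^ z (ℕ.suc k))) (sym (ι-* (z ^ℤ ℕ.suc k) z))

-- Changes of variables

open import Data.Rational using (_+_; _*_; _-_; -_)

translate : ℚ → ℚ → ℚ → Weierstrass → Weierstrass
translate r s t (wm a₁ a₂ a₃ a₄ a₆) =
  wm (ℚʷ.τ₁ a₁ s) (ℚʷ.τ₂ a₁ a₂ r s) (ℚʷ.τ₃ a₁ a₃ r t) (ℚʷ.τ₄ a₁ a₂ a₃ a₄ r s t) (ℚʷ.τ₆ a₁ a₂ a₃ a₄ a₆ r t)

scale : ℚ → Weierstrass → Weierstrass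
scale u (wm a₁ a₂ a₃ a₄ a₆) =
  wm (u * a₁) (u * u * a₂) (u * u * u * a₃) (u * u * u * u * a₄) (u * u * u * u * u * u * a₆)

wm-cong : ∀ {a₁ a₂ a₃ a₄ a₆ b₁ b₂ b₃ b₄ b₆} →
  a₁ ≡ b₁ → a₂ ≡ b₂ → a₃ ≡ b₃ → a₄ ≡ b₄ → a₆ ≡ b₆ → wm a₁ a₂ a₃ a₄ a₆ ≡ wm b₁ b₂ b₃ b₄ b₆
wm-cong refl refl refl refl refl = refl

Transforms⇒scale≡translate : ∀ W u r s t W′ →
  Transforms W u r s t W′ → scale u W′ ≡ translate r s t W
Transforms⇒scale≡translate _ _ _ _ _ _ (_ , e₁ , e₂ , e₃ , e₄ , e₆) = wm-cong e₁ e₂ e₃ e₄ e₆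

scale≡translate⇒Transforms : ∀ W u r s t W′ →
  u ≢ 0ℚ → scale u W′ ≡ translate r s t W → Transforms W u r s t W′
scale≡translate⇒Transforms _ _ _ _ _ _ u≢0 e = u≢0 , cong a₁ e , cong a₂ e , cong a₃ e , cong a₄ e , cong a₆ e

c₄-translate : ∀ r s t W → c₄ (translate r s t W) ≡ c₄ W
c₄-translate r s t (wm a₁ a₂ a₃ a₄ a₆) =
  ℚ-solve 7 (λ a₁ a₂ a₃ a₄ r s t →
      C₄ (τ₁ a₁ s) (τ₂ a₁ a₂ r s) (τ₃ a₁ a₃ r t) (τ₄ a₁ a₂ a₃ a₄ r s t) , C₄ a₁ a₂ a₃ a₄)
    refl a₁ a₂ a₃ a₄ r s t
  where open ℚᵉ

c₆-translate : ∀ r s t W → c₆ (translate r s t W) ≡ c₆ W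
c₆-translate r s t (wm a₁ a₂ a₃ a₄ a₆) =
  ℚ-solve 8 (λ a₁ a₂ a₃ a₄ a₆ r s t →
      C₆ (τ₁ a₁ s) (τ₂ a₁ a₂ r s) (τ₃ a₁ a₃ r t) (τ₄ a₁ a₂ a₃ a₄ r s t) (τ₆ a₁ a₂ a₃ a₄ a₆ r t)
      , C₆ a₁ a₂ a₃ a₄ a₆)
    refl a₁ a₂ a₃ a₄ a₆ r s t
  where open ℚᵉ

Δ-translate : ∀ r s t W → Δ (translate r s t W) ≡ Δ W
Δ-translate r s t W =
  cong₂ (λ x y → (x * x * x - y * y) * (+ 1 ℚ./ 1728)) (c₄-translate r s t W) (c₆-translate r s t W)

c₄-scale : ∀ u W → c₄ (scale u W) ≡ (u * u) * (u * u) * c₄ W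
c₄-scale u (wm a₁ a₂ a₃ a₄ a₆) =
  ℚ-solve 5 (λ u a₁ a₂ a₃ a₄ →
      C₄ (u ⊗ a₁) (u ⊗ u ⊗ a₂) (u ⊗ u ⊗ u ⊗ a₃) (u ⊗ u ⊗ u ⊗ u ⊗ a₄)
      , (u ⊗ u) ⊗ (u ⊗ u) ⊗ C₄ a₁ a₂ a₃ a₄)
    refl u a₁ a₂ a₃ a₄
  where open ℚᵉ

c₆-scale : ∀ u W → c₆ (scale u W) ≡ (u * u) * (u * u) * (u * u) * c₆ W
c₆-scale u (wm a₁ a₂ a₃ a₄ a₆) =
  ℚ-solve 6 (λ u a₁ a₂ a₃ a₄ a₆ →
      C₆ (u ⊗ a₁) (u ⊗ u ⊗ a₂) (u ⊗ u ⊗ u ⊗ a₃) (u ⊗ u ⊗ u ⊗ u ⊗ a₄) (u ⊗ u ⊗ u ⊗ u ⊗ u ⊗ u ⊗ a₆)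
      , (u ⊗ u) ⊗ (u ⊗ u) ⊗ (u ⊗ u) ⊗ C₆ a₁ a₂ a₃ a₄ a₆)
    refl u a₁ a₂ a₃ a₄ a₆
  where open ℚᵉ

translate-translate : ∀ r s t r′ s′ t′ W →
  translate r′ s′ t′ (translate r s t W) ≡ translate (r + r′) (s + s′) (t + t′ + s * r′) W
translate-translate r s t r′ s′ t′ (wm a₁ a₂ a₃ a₄ a₆) = wm-cong
  (ℚ-solve 3 (λ a₁ s s′ → τ₁ (τ₁ a₁ s) s′ , τ₁ a₁ (s ⊕ s′)) refl a₁ s s′)
  (ℚ-solve 6 (λ a₁ a₂ r s r′ s′ → τ₂ (τ₁ a₁ s) (τ₂ a₁ a₂ r s) r′ s′ , τ₂ a₁ a₂ (r ⊕ r′) (s ⊕ s′))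
    refl a₁ a₂ r s r′ s′)
  (ℚ-solve 7 (λ a₁ a₃ r s t r′ t′ →
      τ₃ (τ₁ a₁ s) (τ₃ a₁ a₃ r t) r′ t′ , τ₃ a₁ a₃ (r ⊕ r′) (t ⊕ t′ ⊕ s ⊗ r′))
    refl a₁ a₃ r s t r′ t′)
  (ℚ-solve 10 (λ a₁ a₂ a₃ a₄ r s t r′ s′ t′ →
      τ₄ (τ₁ a₁ s) (τ₂ a₁ a₂ r s) (τ₃ a₁ a₃ r t) (τ₄ a₁ a₂ a₃ a₄ r s t) r′ s′ t′
      , τ₄ a₁ a₂ a₃ a₄ (r ⊕ r′) (s ⊕ s′) (t ⊕ t′ ⊕ s ⊗ r′))
    refl a₁ a₂ a₃ a₄ r s t r′ s′ t′)
  (ℚ-solve 10 (λ a₁ a₂ a₃ a₄ a₆ r s t r′ t′ →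
      τ₆ (τ₁ a₁ s) (τ₂ a₁ a₂ r s) (τ₃ a₁ a₃ r t) (τ₄ a₁ a₂ a₃ a₄ r s t) (τ₆ a₁ a₂ a₃ a₄ a₆ r t) r′ t′
      , τ₆ a₁ a₂ a₃ a₄ a₆ (r ⊕ r′) (t ⊕ t′ ⊕ s ⊗ r′))
    refl a₁ a₂ a₃ a₄ a₆ r s t r′ t′)
  where open ℚᵉ

scale-translate : ∀ u r s t W →
  scale u (translate r s t W) ≡ translate (u * u * r) (u * s) (u * u * u * t) (scale u W)
scale-translate u r s t (wm a₁ a₂ a₃ a₄ a₆) = wm-cong
  (ℚ-solve 3 (λ u a₁ s → u ⊗ τ₁ a₁ s , τ₁ (u ⊗ a₁) (u ⊗ s)) refl u a₁ s)
  (ℚ-solve 5 (λ u a₁ a₂ r s →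
      u ⊗ u ⊗ τ₂ a₁ a₂ r s , τ₂ (u ⊗ a₁) (u ⊗ u ⊗ a₂) (u ⊗ u ⊗ r) (u ⊗ s))
    refl u a₁ a₂ r s)
  (ℚ-solve 5 (λ u a₁ a₃ r t →
      u ⊗ u ⊗ u ⊗ τ₃ a₁ a₃ r t , τ₃ (u ⊗ a₁) (u ⊗ u ⊗ u ⊗ a₃) (u ⊗ u ⊗ r) (u ⊗ u ⊗ u ⊗ t))
    refl u a₁ a₃ r t)
  (ℚ-solve 8 (λ u a₁ a₂ a₃ a₄ r s t →
      u ⊗ u ⊗ u ⊗ u ⊗ τ₄ a₁ a₂ a₃ a₄ r s t
      , τ₄ (u ⊗ a₁) (u ⊗ u ⊗ a₂) (u ⊗ u ⊗ u ⊗ a₃) (u ⊗ u ⊗ u ⊗ u ⊗ a₄)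
           (u ⊗ u ⊗ r) (u ⊗ s) (u ⊗ u ⊗ u ⊗ t))
    refl u a₁ a₂ a₃ a₄ r s t)
  (ℚ-solve 8 (λ u a₁ a₂ a₃ a₄ a₆ r t →
      u ⊗ u ⊗ u ⊗ u ⊗ u ⊗ u ⊗ τ₆ a₁ a₂ a₃ a₄ a₆ r t
      , τ₆ (u ⊗ a₁) (u ⊗ u ⊗ a₂) (u ⊗ u ⊗ u ⊗ a₃) (u ⊗ u ⊗ u ⊗ u ⊗ a₄)
           (u ⊗ u ⊗ u ⊗ u ⊗ u ⊗ u ⊗ a₆) (u ⊗ u ⊗ r) (u ⊗ u ⊗ u ⊗ t))
    refl u a₁ a₂ a₃ a₄ a₆ r t)
  where open ℚᵉ

≅-translate : ∀ {E W} r′ s′ t′ → E ≅ W → E ≅ translate r′ s′ t′ W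
≅-translate {E} {W} r′ s′ t′ (u , r , s , t , E→W) =
  u , r″ , s″ , t″ , scale≡translate⇒Transforms E u r″ s″ t″ (translate r′ s′ t′ W) (proj₁ E→W) (begin
    scale u (translate r′ s′ t′ W)
      ≡⟨ scale-translate u r′ s′ t′ W ⟩
    translate (u * u * r′) (u * s′) (u * u * u * t′) (scale u W)
      ≡⟨ cong (translate (u * u * r′) (u * s′) (u * u * u * t′)) (Transforms⇒scale≡translate E u r s t W E→W) ⟩
    translate (u * u * r′) (u * s′) (u * u * u * t′) (translate r s t E)
      ≡⟨ translate-translate r s t (u * u * r′) (u * s′) (u * u * u * t′) E ⟩
    translate r″ s″ t″ E
      ∎)
  where
  open ≡-Reasoning
  r″ = r + u * u * r′
  s″ = s + u * s′
  t″ = t + u * u * u * t′ + s * (u * u * r′)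

-- Global minimal models share c₄ and c₆

infixl 8 _⁶
_⁶ : ℚ → ℚ
p ⁶ = p * p * p * p * p * p

*-cancelˡ-≢0 : ∀ {r p q} → r ≢ 0ℚ → r * p ≡ r * q → p ≡ q
*-cancelˡ-≢0 {r} {p} {q} r≢0 rp≡rq = begin
  p              ≡⟨ cancel p ⟨
  1/ r * (r * p) ≡⟨ cong (1/ r *_) rp≡rq ⟩
  1/ r * (r * q) ≡⟨ cancel q ⟩
  q              ∎
  where
  open ≡-Reasoning
  instance _ = ≢-nonZero r≢0
  cancel : ∀ x → 1/ r * (r * x) ≡ x
  cancel x = trans (sym (ℚP.*-assoc (1/ r) r x))
    (trans (cong (_* x) (ℚP.*-inverseˡ r)) (ℚP.*-identityˡ x))

*-pos : ∀ {p q} → 0ℚ < p → 0ℚ < q → 0ℚ < p * q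
*-pos {p} {q} 0<p 0<q =
  ℚP.positive⁻¹ (p * q) {{ℚP.pos*pos⇒pos p {{positive 0<p}} q {{positive 0<q}}}}

*-mono-<-pos : ∀ {p q r s} → 0ℚ < p → p < q → 0ℚ < r → r < s → p * r < q * s
*-mono-<-pos {p} {q} {r} {s} 0<p p<q 0<r r<s =
  ℚP.<-trans (ℚP.*-monoˡ-<-pos r {{positive 0<r}} p<q)
             (ℚP.*-monoʳ-<-pos q {{positive (ℚP.<-trans 0<p p<q)}} r<s)

square-pos : ∀ {u} → u ≢ 0ℚ → 0ℚ < u * u
square-pos {u} u≢0 with ℚP.<-cmp u 0ℚ
... | tri< u<0 _ _ = ℚP.positive⁻¹ (u * u) {{ℚP.neg*neg⇒pos u {{negative u<0}} u {{negative u<0}}}}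
... | tri≈ _ u≡0 _ = ⊥-elim (u≢0 u≡0)
... | tri> _ _ 0<u = *-pos 0<u 0<u

⁶-mono-< : ∀ {p q} → 0ℚ < p → p < q → p ⁶ < q ⁶
⁶-mono-< {p} {q} 0<p p<q = times (times (times (times (times p<q 0<p) 0<p²) 0<p³) 0<p⁴) 0<p⁵
  where
  times : ∀ {x y} → x < y → 0ℚ < x → x * p < y * q
  times x<y 0<x = *-mono-<-pos 0<x x<y 0<p p<q
  0<p² = *-pos 0<p 0<p
  0<p³ = *-pos 0<p² 0<p
  0<p⁴ = *-pos 0<p³ 0<p
  0<p⁵ = *-pos 0<p⁴ 0<p

⁶-injective-pos : ∀ {p q} → 0ℚ < p → 0ℚ < q → p ⁶ ≡ q ⁶ → p ≡ q
⁶-injective-pos {p} {q} 0<p 0<q p⁶≡q⁶ with ℚP.<-cmp p q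
... | tri< p<q _ _ = ⊥-elim (ℚP.<-irrefl p⁶≡q⁶ (⁶-mono-< 0<p p<q))
... | tri≈ _ p≡q _ = p≡q
... | tri> _ _ q<p = ⊥-elim (ℚP.<-irrefl (sym p⁶≡q⁶) (⁶-mono-< 0<q q<p))

module _ W u r s t W′ (W→W′ : Transforms W u r s t W′) where

  c₄-Transforms : c₄ W ≡ (u * u) * (u * u) * c₄ W′
  c₄-Transforms = begin
    c₄ W                     ≡⟨ c₄-translate r s t W ⟨
    c₄ (translate r s t W)   ≡⟨ cong c₄ (Transforms⇒scale≡translate W u r s t W′ W→W′) ⟨
    c₄ (scale u W′)          ≡⟨ c₄-scale u W′ ⟩
    (u * u) * (u * u) * c₄ W′ ∎
    where open ≡-Reasoning

  c₆-Transforms : c₆ W ≡ (u * u) * (u * u) * (u * u) * c₆ W′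
  c₆-Transforms = begin
    c₆ W                              ≡⟨ c₆-translate r s t W ⟨
    c₆ (translate r s t W)            ≡⟨ cong c₆ (Transforms⇒scale≡translate W u r s t W′ W→W′) ⟨
    c₆ (scale u W′)                   ≡⟨ c₆-scale u W′ ⟩
    (u * u) * (u * u) * (u * u) * c₆ W′ ∎
    where open ≡-Reasoning

  Δ-Transforms : Δ W ≡ (u * u) ⁶ * Δ W′
  Δ-Transforms =
    trans (cong₂ (λ x y → (x * x * x - y * y) * (+ 1 ℚ./ 1728)) c₄-Transforms c₆-Transforms)
          (ℚ-solve 4 (λ U x y k →
              ((U ⊗ U ⊗ x) ⊗ (U ⊗ U ⊗ x) ⊗ (U ⊗ U ⊗ x) ⊕ ⊝ ((U ⊗ U ⊗ U ⊗ y) ⊗ (U ⊗ U ⊗ U ⊗ y))) ⊗ k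
              , U ⊗ U ⊗ U ⊗ U ⊗ U ⊗ U ⊗ ((x ⊗ x ⊗ x ⊕ ⊝ (y ⊗ y)) ⊗ k))
            refl (u * u) (c₄ W′) (c₆ W′) (+ 1 ℚ./ 1728))

  ∣Δ∣-Transforms : ∣ Δ W ∣ ≡ (u * u) ⁶ * ∣ Δ W′ ∣
  ∣Δ∣-Transforms = begin
    ∣ Δ W ∣                  ≡⟨ cong ∣_∣ Δ-Transforms ⟩
    ∣ (u * u) ⁶ * Δ W′ ∣     ≡⟨ ℚP.∣p*q∣≡∣p∣*∣q∣ ((u * u) ⁶) (Δ W′) ⟩
    ∣ (u * u) ⁶ ∣ * ∣ Δ W′ ∣ ≡⟨ cong (_* ∣ Δ W′ ∣) (ℚP.0≤p⇒∣p∣≡p (ℚP.<⇒≤ 0<U⁶)) ⟩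
    (u * u) ⁶ * ∣ Δ W′ ∣     ∎
    where
    open ≡-Reasoning
    0<U = square-pos (proj₁ W→W′)
    0<U⁶ = *-pos (*-pos (*-pos (*-pos (*-pos 0<U 0<U) 0<U) 0<U) 0<U) 0<U

≅-∣Δ∣≡⇒c₄≡×c₆≡ : ∀ E M M′ → Δ E ≢ 0ℚ → E ≅ M → E ≅ M′ → ∣ Δ M ∣ ≡ ∣ Δ M′ ∣ →
  c₄ M ≡ c₄ M′ × c₆ M ≡ c₆ M′
≅-∣Δ∣≡⇒c₄≡×c₆≡ E M M′ ΔE≢0 (u , r , s , t , E→M) (v , r′ , s′ , t′ , E→M′) ∣ΔM∣≡∣ΔM′∣ =
  *-cancelˡ-≢0 U²≢0 (begin
    U * U * c₄ M   ≡⟨ c₄-Transforms E u r s t M E→M ⟨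
    c₄ E           ≡⟨ c₄-Transforms E v r′ s′ t′ M′ E→M′ ⟩
    V * V * c₄ M′  ≡⟨ cong (λ w → w * w * c₄ M′) U≡V ⟨
    U * U * c₄ M′  ∎) ,
  *-cancelˡ-≢0 U³≢0 (begin
    U * U * U * c₆ M   ≡⟨ c₆-Transforms E u r s t M E→M ⟨
    c₆ E               ≡⟨ c₆-Transforms E v r′ s′ t′ M′ E→M′ ⟩
    V * V * V * c₆ M′  ≡⟨ cong (λ w → w * w * w * c₆ M′) U≡V ⟨
    U * U * U * c₆ M′  ∎)
  where
  open ≡-Reasoning
  U = u * u
  V = v * v
  0<U = square-pos (proj₁ E→M)
  U²≢0 = ≢-sym (ℚP.<⇒≢ (*-pos 0<U 0<U))
  U³≢0 = ≢-sym (ℚP.<⇒≢ (*-pos (*-pos 0<U 0<U) 0<U))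
  ∣ΔM∣≢0 : ∣ Δ M ∣ ≢ 0ℚ
  ∣ΔM∣≢0 ∣ΔM∣≡0 = ΔE≢0 (ℚP.∣p∣≡0⇒p≡0 (Δ E) (trans (∣Δ∣-Transforms E u r s t M E→M)
    (trans (cong (U ⁶ *_) ∣ΔM∣≡0) (ℚP.*-zeroʳ (U ⁶)))))
  U≡V : U ≡ V
  U≡V = ⁶-injective-pos 0<U (square-pos (proj₁ E→M′))
    (*-cancelˡ-≢0 ∣ΔM∣≢0 (begin
      ∣ Δ M ∣ * U ⁶ ≡⟨ ℚP.*-comm ∣ Δ M ∣ (U ⁶) ⟩
      U ⁶ * ∣ Δ M ∣ ≡⟨ ∣Δ∣-Transforms E u r s t M E→M ⟨
      ∣ Δ E ∣       ≡⟨ ∣Δ∣-Transforms E v r′ s′ t′ M′ E→M′ ⟩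
      V ⁶ * ∣ Δ M′ ∣ ≡⟨ cong (V ⁶ *_) ∣ΔM∣≡∣ΔM′∣ ⟨
      V ⁶ * ∣ Δ M ∣ ≡⟨ ℚP.*-comm (V ⁶) ∣ Δ M ∣ ⟩
      ∣ Δ M ∣ * V ⁶ ∎))

globalMinimal⇒c₄≡×c₆≡ : ∀ E M M′ → Δ E ≢ 0ℚ → IsGlobalMinimal E M → IsGlobalMinimal E M′ →
  c₄ M ≡ c₄ M′ × c₆ M ≡ c₆ M′
globalMinimal⇒c₄≡×c₆≡ E M M′ ΔE≢0 (M-int , E≅M , M-min) (M′-int , E≅M′ , M′-min) =
  ≅-∣Δ∣≡⇒c₄≡×c₆≡ E M M′ ΔE≢0 E≅M E≅M′ (ℚP.≤-antisym (M-min M′ M′-int E≅M′) (M′-min M M-int E≅M))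

-- Integers modulo n

private
  no-smaller-quotient : ∀ {a q q′ : ℤ} {r r′ n : ℕ} → r ℕ.< n →
    a ≡ + r ℤ.+ q ℤ.* + n → a ≡ + r′ ℤ.+ q′ ℤ.* + n → q ℤ.< q′ → ⊥
  no-smaller-quotient {a} {q} {q′} {r} {r′} {n} r<n a≡ a≡′ q<q′ = ℤP.<-irrefl refl (begin-strict
    a                    ≡⟨ a≡ ⟩
    + r ℤ.+ q ℤ.* + n    <⟨ ℤP.+-monoˡ-< (q ℤ.* + n) (ℤ.+<+ r<n) ⟩
    + n ℤ.+ q ℤ.* + n    ≡⟨ ℤP.suc-* q (+ n) ⟨
    ℤ.suc q ℤ.* + n      ≤⟨ ℤP.*-monoʳ-≤-nonNeg (+ n) (ℤP.i<j⇒suc[i]≤j q<q′) ⟩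
    q′ ℤ.* + n           ≤⟨ ℤP.i≤j+i (q′ ℤ.* + n) (+ r′) ⟩
    + r′ ℤ.+ q′ ℤ.* + n  ≡⟨ a≡′ ⟨
    a                    ∎)
    where open ℤP.≤-Reasoning

divMod-unique : ∀ {a q : ℤ} {r n : ℕ} .{{_ : ℕ.NonZero n}} → r ℕ.< n →
  a ≡ + r ℤ.+ q ℤ.* + n → a ℤD.% + n ≡ r × a ℤD./ + n ≡ q
divMod-unique {a} {q} {r} {n} r<n a≡ with ℤP.<-cmp q (a ℤD./ + n)
... | tri< q<a/n _ _ = ⊥-elim (no-smaller-quotient r<n a≡ (ℤD.a≡a%n+[a/n]*n a (+ n)) q<a/n)
... | tri> _ _ a/n<q = ⊥-elim (no-smaller-quotient (ℤD.n%d<d a (+ n)) (ℤD.a≡a%n+[a/n]*n a (+ n)) a≡ a/n<q)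
... | tri≈ _ q≡a/n _ = ℤP.+-injective (sym (+-cancelʳ (q ℤ.* + n) (+ r) (+ (a ℤD.% + n)) (begin
    + r ℤ.+ q ℤ.* + n                    ≡⟨ a≡ ⟨
    a                                    ≡⟨ ℤD.a≡a%n+[a/n]*n a (+ n) ⟩
    + (a ℤD.% + n) ℤ.+ a ℤD./ + n ℤ.* + n ≡⟨ cong (λ x → + (a ℤD.% + n) ℤ.+ x ℤ.* + n) q≡a/n ⟨
    + (a ℤD.% + n) ℤ.+ q ℤ.* + n         ∎))) , sym q≡a/n
  where open ≡-Reasoning

private
  shift-quotient : ∀ x y m k → x ℤ.+ y ℤ.* k ℤ.+ m ℤ.* k ≡ x ℤ.+ (y ℤ.+ m) ℤ.* k
  shift-quotient = ℤ-Tactic.solve-∀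

%-periodic : ∀ a m n .{{_ : ℕ.NonZero n}} → (a ℤ.+ m ℤ.* + n) ℤD.% + n ≡ a ℤD.% + n
%-periodic a m n = proj₁ (divMod-unique {a ℤ.+ m ℤ.* + n} {a ℤD./ + n ℤ.+ m} (ℤD.n%d<d a (+ n))
  (trans (cong (ℤ._+ m ℤ.* + n) (ℤD.a≡a%n+[a/n]*n a (+ n)))
         (shift-quotient (+ (a ℤD.% + n)) (a ℤD./ + n) m (+ n))))

/-periodic : ∀ a m q d .{{_ : ℕ.NonZero d}} →
  (a ℤ.+ m ℤ.* (+ q ℤ.* + d)) ℤD./ + d ≡ a ℤD./ + d ℤ.+ m ℤ.* + q
/-periodic a m q d = proj₂ (divMod-unique {a ℤ.+ m ℤ.* (+ q ℤ.* + d)} {a ℤD./ + d ℤ.+ m ℤ.* + q}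
  (ℤD.n%d<d a (+ d)) (begin
    a ℤ.+ m ℤ.* (+ q ℤ.* + d)
      ≡⟨ cong (λ x → a ℤ.+ x) (ℤP.*-assoc m (+ q) (+ d)) ⟨
    a ℤ.+ m ℤ.* + q ℤ.* + d
      ≡⟨ cong (ℤ._+ m ℤ.* + q ℤ.* + d) (ℤD.a≡a%n+[a/n]*n a (+ d)) ⟩
    + (a ℤD.% + d) ℤ.+ a ℤD./ + d ℤ.* + d ℤ.+ m ℤ.* + q ℤ.* + d
      ≡⟨ shift-quotient (+ (a ℤD.% + d)) (a ℤD./ + d) (m ℤ.* + q) (+ d) ⟩
    + (a ℤD.% + d) ℤ.+ (a ℤD./ + d ℤ.+ m ℤ.* + q) ℤ.* + d
      ∎))
  where open ≡-Reasoning

∣⇒%≡ : ∀ {a b} n .{{_ : ℕ.NonZero n}} → + n ∣ a ℤ.- b → a ℤD.% + n ≡ b ℤD.% + n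
∣⇒%≡ {a} {b} n n∣a-b with Signed.∣ᵤ⇒∣ n∣a-b
... | Signed.divides k a-b≡k*n = trans (cong (ℤD._% + n) a≡b+k*n) (%-periodic b k n)
  where
  a≡b+k*n : a ≡ b ℤ.+ k ℤ.* + n
  a≡b+k*n = trans (sym (rearrange a b)) (cong (λ x → b ℤ.+ x) a-b≡k*n)
    where
    rearrange : ∀ a b → b ℤ.+ (a ℤ.- b) ≡ a
    rearrange = ℤ-Tactic.solve-∀

%2-binary : ∀ z → + (z ℤD.% + 2) ≡ + 0 ⊎ + (z ℤD.% + 2) ≡ + 1
%2-binary z with z ℤD.% + 2 | ℤD.n%d<d z (+ 2)
... | 0 | _ = inj₁ refl
... | 1 | _ = inj₂ refl
... | ℕ.suc (ℕ.suc _) | ℕ.s≤s (ℕ.s≤s ())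

reduce-mod : ∀ z n .{{_ : ℕ.NonZero n}} → z ℤ.+ + n ℤ.* ℤ.- (z ℤD./ + n) ≡ + (z ℤD.% + n)
reduce-mod z n = trans (cong (ℤ._+ + n ℤ.* ℤ.- (z ℤD./ + n)) (ℤD.a≡a%n+[a/n]*n z (+ n)))
  (cancel (+ (z ℤD.% + n)) (z ℤD./ + n) (+ n))
  where
  cancel : ∀ x q k → x ℤ.+ q ℤ.* k ℤ.+ k ℤ.* ℤ.- q ≡ x
  cancel = ℤ-Tactic.solve-∀

reduce-mod2 : ∀ z → Σ ℤ λ s → z ℤ.+ + 2 ℤ.* s ≡ + 0 ⊎ z ℤ.+ + 2 ℤ.* s ≡ + 1
reduce-mod2 z = ℤ.- (z ℤD./ + 2) , Sum.map (trans (reduce-mod z 2)) (trans (reduce-mod z 2)) (%2-binary z)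

reduce-mod3 : ∀ z → Σ ℤ λ r →
  z ℤ.+ + 3 ℤ.* r ≡ -[1+ 0 ] ⊎ z ℤ.+ + 3 ℤ.* r ≡ + 0 ⊎ z ℤ.+ + 3 ℤ.* r ≡ + 1
reduce-mod3 z with z ℤD.% + 3 | ℤD.n%d<d z (+ 3) | reduce-mod z 3
... | 0 | _ | e = ℤ.- (z ℤD./ + 3) , inj₂ (inj₁ e)
... | 1 | _ | e = ℤ.- (z ℤD./ + 3) , inj₂ (inj₂ e)
... | 2 | _ | e = ℤ.- (z ℤD./ + 3) ℤ.- + 1 , inj₁ (trans (step z (ℤ.- (z ℤD./ + 3))) (cong (ℤ._- + 3) e))
  where
  step : ∀ z q → z ℤ.+ + 3 ℤ.* (q ℤ.- + 1) ≡ z ℤ.+ + 3 ℤ.* q ℤ.- + 3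
  step = ℤ-Tactic.solve-∀
... | ℕ.suc (ℕ.suc (ℕ.suc _)) | ℕ.s≤s (ℕ.s≤s (ℕ.s≤s ())) | _

-- Integral models

integral : ℤ → ℤ → ℤ → ℤ → ℤ → Weierstrass
integral a₁ a₂ a₃ a₄ a₆ = wm (ι a₁) (ι a₂) (ι a₃) (ι a₄) (ι a₆)

integral-isIntegral : ∀ a₁ a₂ a₃ a₄ a₆ → IsIntegral (integral a₁ a₂ a₃ a₄ a₆)
integral-isIntegral a₁ a₂ a₃ a₄ a₆ = (a₁ , refl) , (a₂ , refl) , (a₃ , refl) , (a₄ , refl) , (a₆ , refl)

integral-isReducedForm : ∀ {a₁ a₂ a₃} a₄ a₆ →
  (a₁ ≡ + 0 ⊎ a₁ ≡ + 1) → (a₃ ≡ + 0 ⊎ a₃ ≡ + 1) → (a₂ ≡ -[1+ 0 ] ⊎ a₂ ≡ + 0 ⊎ a₂ ≡ + 1) →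
  IsReducedForm (integral a₁ a₂ a₃ a₄ a₆)
integral-isReducedForm _ _ a₁∈ a₃∈ a₂∈ =
  Sum.map (cong ι) (cong ι) a₁∈ , Sum.map (cong ι) (cong ι) a₃∈ ,
  Sum.map (cong ι) (Sum.map (cong ι) (cong ι)) a₂∈

module _ (a₁ a₂ a₃ a₄ a₆ : ℤ) where
  open ℤᵉ

  c₄-integral : c₄ (integral a₁ a₂ a₃ a₄ a₆) ≡ ι (ℤʷ.C₄ a₁ a₂ a₃ a₄)
  c₄-integral = ι-⟦⟧ (C₄ (Ι 0F) (Ι 1F) (Ι 2F) (Ι 3F)) (a₁ Vec.∷ a₂ Vec.∷ a₃ Vec.∷ a₄ Vec.∷ Vec.[])

  c₆-integral : c₆ (integral a₁ a₂ a₃ a₄ a₆) ≡ ι (ℤʷ.C₆ a₁ a₂ a₃ a₄ a₆)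
  c₆-integral = ι-⟦⟧ (C₆ (Ι 0F) (Ι 1F) (Ι 2F) (Ι 3F) (Ι 4F))
    (a₁ Vec.∷ a₂ Vec.∷ a₃ Vec.∷ a₄ Vec.∷ a₆ Vec.∷ Vec.[])

  translate-integral : ∀ r s t → translate (ι r) (ι s) (ι t) (integral a₁ a₂ a₃ a₄ a₆) ≡
    integral (ℤʷ.τ₁ a₁ s) (ℤʷ.τ₂ a₁ a₂ r s) (ℤʷ.τ₃ a₁ a₃ r t) (ℤʷ.τ₄ a₁ a₂ a₃ a₄ r s t) (ℤʷ.τ₆ a₁ a₂ a₃ a₄ a₆ r t)
  translate-integral r s t = wm-cong
    (ι-⟦⟧ (τ₁ (Ι 0F) (Ι 6F)) ρ)
    (ι-⟦⟧ (τ₂ (Ι 0F) (Ι 1F) (Ι 5F) (Ι 6F)) ρ)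
    (ι-⟦⟧ (τ₃ (Ι 0F) (Ι 2F) (Ι 5F) (Ι 7F)) ρ)
    (ι-⟦⟧ (τ₄ (Ι 0F) (Ι 1F) (Ι 2F) (Ι 3F) (Ι 5F) (Ι 6F) (Ι 7F)) ρ)
    (ι-⟦⟧ (τ₆ (Ι 0F) (Ι 1F) (Ι 2F) (Ι 3F) (Ι 4F) (Ι 5F) (Ι 7F)) ρ)
    where ρ = a₁ Vec.∷ a₂ Vec.∷ a₃ Vec.∷ a₄ Vec.∷ a₆ Vec.∷ r Vec.∷ s Vec.∷ t Vec.∷ Vec.[]

reduced-translate : ∀ W → IsIntegral W →
  Σ ℚ λ r → Σ ℚ λ s → Σ ℚ λ t → IsIntegral (translate r s t W) × IsReducedForm (translate r s t W)
reduced-translate (wm _ _ _ _ _) ((a₁ , refl) , (a₂ , refl) , (a₃ , refl) , (a₄ , refl) , (a₆ , refl))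
  with reduce-mod2 a₁
... | s , a₁′∈ with reduce-mod3 (ℤʷ.τ₂ a₁ a₂ (+ 0) s)
... | r , a₂′∈ with reduce-mod2 (ℤʷ.τ₃ a₁ a₃ r (+ 0))
... | t , a₃′∈ = ι r , ι s , ι t ,
  subst (λ M → IsIntegral M × IsReducedForm M) (sym (translate-integral a₁ a₂ a₃ a₄ a₆ r s t))
    ( integral-isIntegral (ℤʷ.τ₁ a₁ s) (ℤʷ.τ₂ a₁ a₂ r s) (ℤʷ.τ₃ a₁ a₃ r t) b₄ b₆
    , integral-isReducedForm b₄ b₆ a₁′∈
        (subst (λ x → x ≡ + 0 ⊎ x ≡ + 1) (sym τ₃-split) a₃′∈)
        (subst (λ x → x ≡ -[1+ 0 ] ⊎ x ≡ + 0 ⊎ x ≡ + 1) (sym τ₂-split) a₂′∈))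
  where
  open ℤᵉ
  b₄ = ℤʷ.τ₄ a₁ a₂ a₃ a₄ r s t
  b₆ = ℤʷ.τ₆ a₁ a₂ a₃ a₄ a₆ r t
  τ₂-split : ℤʷ.τ₂ a₁ a₂ r s ≡ ℤʷ.τ₂ a₁ a₂ (+ 0) s ℤ.+ + 3 ℤ.* r
  τ₂-split = ℤ-solve 4 (λ a₁ a₂ r s → τ₂ a₁ a₂ r s , τ₂ a₁ a₂ (Κ (+ 0)) s ⊕ Κ (+ 3) ⊗ r) refl a₁ a₂ r s
  τ₃-split : ℤʷ.τ₃ a₁ a₃ r t ≡ ℤʷ.τ₃ a₁ a₃ r (+ 0) ℤ.+ + 2 ℤ.* t
  τ₃-split = ℤ-solve 4 (λ a₁ a₃ r t → τ₃ a₁ a₃ r t , τ₃ a₁ a₃ r (Κ (+ 0)) ⊕ Κ (+ 2) ⊗ t) refl a₁ a₃ r t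

-- The twelve reduced models

reducedModel : Idx → ℤ → ℤ → Weierstrass
reducedModel i a₄ a₆ = let (x₁ , x₂ , x₃) = R i in integral x₁ x₂ x₃ a₄ a₆

reducedModel-view : ∀ M → IsIntegral M → IsReducedForm M →
  Σ Idx λ i → Σ ℤ λ a₄ → Σ ℤ λ a₆ → M ≡ reducedModel i a₄ a₆
reducedModel-view (wm _ _ _ _ _) (_ , _ , _ , (a₄ , refl) , (a₆ , refl)) reduced = view reduced
  where
  view : ∀ {a₁ a₂ a₃} → IsReducedForm (wm a₁ a₂ a₃ (ι a₄) (ι a₆)) →
    Σ Idx λ i → Σ ℤ λ a₄′ → Σ ℤ λ a₆′ → wm a₁ a₂ a₃ (ι a₄) (ι a₆) ≡ reducedModel i a₄′ a₆′
  view (inj₁ refl , inj₁ refl , inj₂ (inj₁ refl)) = i1  , a₄ , a₆ , refl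
  view (inj₁ refl , inj₂ refl , inj₂ (inj₁ refl)) = i2  , a₄ , a₆ , refl
  view (inj₁ refl , inj₁ refl , inj₁ refl)        = i3  , a₄ , a₆ , refl
  view (inj₁ refl , inj₂ refl , inj₁ refl)        = i4  , a₄ , a₆ , refl
  view (inj₁ refl , inj₁ refl , inj₂ (inj₂ refl)) = i5  , a₄ , a₆ , refl
  view (inj₁ refl , inj₂ refl , inj₂ (inj₂ refl)) = i6  , a₄ , a₆ , refl
  view (inj₂ refl , inj₁ refl , inj₂ (inj₁ refl)) = i7  , a₄ , a₆ , refl
  view (inj₂ refl , inj₂ refl , inj₂ (inj₁ refl)) = i8  , a₄ , a₆ , refl
  view (inj₂ refl , inj₁ refl , inj₁ refl)        = i9  , a₄ , a₆ , refl
  view (inj₂ refl , inj₂ refl , inj₁ refl)        = i10 , a₄ , a₆ , refl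
  view (inj₂ refl , inj₁ refl , inj₂ (inj₂ refl)) = i11 , a₄ , a₆ , refl
  view (inj₂ refl , inj₂ refl , inj₂ (inj₂ refl)) = i12 , a₄ , a₆ , refl

C₄-affine : ∀ x₁ x₂ x₃ a₄ → ℤʷ.C₄ x₁ x₂ x₃ a₄ ≡ ℤʷ.C₄ x₁ x₂ x₃ (+ 0) ℤ.+ -[1+ 47 ] ℤ.* a₄
C₄-affine = ℤ-solve 4 (λ x₁ x₂ x₃ a₄ → C₄ x₁ x₂ x₃ a₄ , C₄ x₁ x₂ x₃ (Κ (+ 0)) ⊕ Κ -[1+ 47 ] ⊗ a₄) refl
  where open ℤᵉ

C₆-affine : ∀ x₁ x₂ x₃ a₄ a₆ → ℤʷ.C₆ x₁ x₂ x₃ a₄ a₆ ≡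
  ℤʷ.C₆ x₁ x₂ x₃ (+ 0) (+ 0) ℤ.+ + 72 ℤ.* (x₁ ℤ.* x₁ ℤ.+ + 4 ℤ.* x₂) ℤ.* a₄ ℤ.+ -[1+ 863 ] ℤ.* a₆
C₆-affine = ℤ-solve 5 (λ x₁ x₂ x₃ a₄ a₆ →
    C₆ x₁ x₂ x₃ a₄ a₆
    , C₆ x₁ x₂ x₃ (Κ (+ 0)) (Κ (+ 0)) ⊕ Κ (+ 72) ⊗ (x₁ ⊗ x₁ ⊕ Κ (+ 4) ⊗ x₂) ⊗ a₄ ⊕ Κ -[1+ 863 ] ⊗ a₆)
  refl
  where open ℤᵉ

-- AB i unfolds only at a concrete index, hence one (identical) clause per shape.
AB-reducedModel : ∀ i a₄ a₆ → let (x₁ , x₂ , x₃) = R i in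
  AB i (ℤʷ.C₄ x₁ x₂ x₃ (+ 0) ℤ.+ -[1+ 47 ] ℤ.* a₄)
       (ℤʷ.C₆ x₁ x₂ x₃ (+ 0) (+ 0) ℤ.+ + 72 ℤ.* (x₁ ℤ.* x₁ ℤ.+ + 4 ℤ.* x₂) ℤ.* a₄ ℤ.+ -[1+ 863 ] ℤ.* a₆)
  ≡ (+ 48 ℤ.* ℤ.- a₄ , + 1728 ℤ.* ℤ.- a₆)
AB-reducedModel i1  a₄ a₆ = cong₂ _,_ (ℤ-Tactic.solve (a₄ ∷ a₆ ∷ [])) (ℤ-Tactic.solve (a₄ ∷ a₆ ∷ []))
AB-reducedModel i2  a₄ a₆ = cong₂ _,_ (ℤ-Tactic.solve (a₄ ∷ a₆ ∷ [])) (ℤ-Tactic.solve (a₄ ∷ a₆ ∷ []))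
AB-reducedModel i3  a₄ a₆ = cong₂ _,_ (ℤ-Tactic.solve (a₄ ∷ a₆ ∷ [])) (ℤ-Tactic.solve (a₄ ∷ a₆ ∷ []))
AB-reducedModel i4  a₄ a₆ = cong₂ _,_ (ℤ-Tactic.solve (a₄ ∷ a₆ ∷ [])) (ℤ-Tactic.solve (a₄ ∷ a₆ ∷ []))
AB-reducedModel i5  a₄ a₆ = cong₂ _,_ (ℤ-Tactic.solve (a₄ ∷ a₆ ∷ [])) (ℤ-Tactic.solve (a₄ ∷ a₆ ∷ []))
AB-reducedModel i6  a₄ a₆ = cong₂ _,_ (ℤ-Tactic.solve (a₄ ∷ a₆ ∷ [])) (ℤ-Tactic.solve (a₄ ∷ a₆ ∷ []))
AB-reducedModel i7  a₄ a₆ = cong₂ _,_ (ℤ-Tactic.solve (a₄ ∷ a₆ ∷ [])) (ℤ-Tactic.solve (a₄ ∷ a₆ ∷ []))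
AB-reducedModel i8  a₄ a₆ = cong₂ _,_ (ℤ-Tactic.solve (a₄ ∷ a₆ ∷ [])) (ℤ-Tactic.solve (a₄ ∷ a₆ ∷ []))
AB-reducedModel i9  a₄ a₆ = cong₂ _,_ (ℤ-Tactic.solve (a₄ ∷ a₆ ∷ [])) (ℤ-Tactic.solve (a₄ ∷ a₆ ∷ []))
AB-reducedModel i10 a₄ a₆ = cong₂ _,_ (ℤ-Tactic.solve (a₄ ∷ a₆ ∷ [])) (ℤ-Tactic.solve (a₄ ∷ a₆ ∷ []))
AB-reducedModel i11 a₄ a₆ = cong₂ _,_ (ℤ-Tactic.solve (a₄ ∷ a₆ ∷ [])) (ℤ-Tactic.solve (a₄ ∷ a₆ ∷ []))
AB-reducedModel i12 a₄ a₆ = cong₂ _,_ (ℤ-Tactic.solve (a₄ ∷ a₆ ∷ [])) (ℤ-Tactic.solve (a₄ ∷ a₆ ∷ []))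

reducedModel≡model : ∀ i a₄ a₆ {c4 c6} →
  c₄ (reducedModel i a₄ a₆) ≡ ι c4 → c₆ (reducedModel i a₄ a₆) ≡ ι c6 → reducedModel i a₄ a₆ ≡ model i c4 c6
reducedModel≡model i a₄ a₆ {c4} {c6} c₄≡c4 c₆≡c6 = sym (begin
  model i c4 c6
    ≡⟨ cong₂ (model i) c4≡ c6≡ ⟩
  model i (κ₄ ℤ.+ -[1+ 47 ] ℤ.* a₄) (κ₆ ℤ.+ ℓ ℤ.* a₄ ℤ.+ -[1+ 863 ] ℤ.* a₆)
    ≡⟨ cong (λ (A , B) → wm (ι x₁) (ι x₂) (ι x₃) (- (A ℚ./ 48)) (- (B ℚ./ 1728))) (AB-reducedModel i a₄ a₆) ⟩
  wm (ι x₁) (ι x₂) (ι x₃) (- ((+ 48 ℤ.* ℤ.- a₄) ℚ./ 48)) (- ((+ 1728 ℤ.* ℤ.- a₆) ℚ./ 1728))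
    ≡⟨ cong₂ (wm (ι x₁) (ι x₂) (ι x₃)) (neg-*-/-cancel 47 a₄) (neg-*-/-cancel 1727 a₆) ⟩
  reducedModel i a₄ a₆
    ∎)
  where
  open ≡-Reasoning
  x₁ = proj₁ (R i)
  x₂ = proj₁ (proj₂ (R i))
  x₃ = proj₂ (proj₂ (R i))
  κ₄ = ℤʷ.C₄ x₁ x₂ x₃ (+ 0)
  κ₆ = ℤʷ.C₆ x₁ x₂ x₃ (+ 0) (+ 0)
  ℓ = + 72 ℤ.* (x₁ ℤ.* x₁ ℤ.+ + 4 ℤ.* x₂)
  c4≡ : c4 ≡ κ₄ ℤ.+ -[1+ 47 ] ℤ.* a₄
  c4≡ = trans (ι-injective (trans (sym c₄≡c4) (c₄-integral x₁ x₂ x₃ a₄ a₆))) (C₄-affine x₁ x₂ x₃ a₄)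
  c6≡ : c6 ≡ κ₆ ℤ.+ ℓ ℤ.* a₄ ℤ.+ -[1+ 863 ] ℤ.* a₆
  c6≡ = trans (ι-injective (trans (sym c₆≡c6) (c₆-integral x₁ x₂ x₃ a₄ a₆))) (C₆-affine x₁ x₂ x₃ a₄ a₆)

c₆-period : ℤ → ℕ
c₆-period (+ 0) = 48
c₆-period _     = 24

C₆-periodic : ∀ x₁ x₂ x₃ a₄ a₆ → (x₁ ≡ + 0 ⊎ x₁ ≡ + 1) →
  Σ ℤ λ m → ℤʷ.C₆ x₁ x₂ x₃ a₄ a₆ ≡ ℤʷ.C₆ x₁ x₂ x₃ (+ 0) (+ 0) ℤ.+ m ℤ.* + c₆-period x₁
C₆-periodic _ x₂ x₃ a₄ a₆ (inj₁ refl) = + 6 ℤ.* x₂ ℤ.* a₄ ℤ.+ -[1+ 17 ] ℤ.* a₆ ,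
  ℤ-solve 4 (λ x₂ x₃ a₄ a₆ →
      C₆ (Κ (+ 0)) x₂ x₃ a₄ a₆
      , C₆ (Κ (+ 0)) x₂ x₃ (Κ (+ 0)) (Κ (+ 0)) ⊕ (Κ (+ 6) ⊗ x₂ ⊗ a₄ ⊕ Κ -[1+ 17 ] ⊗ a₆) ⊗ Κ (+ 48))
    refl x₂ x₃ a₄ a₆
  where open ℤᵉ
C₆-periodic _ x₂ x₃ a₄ a₆ (inj₂ refl) = (+ 3 ℤ.+ + 12 ℤ.* x₂) ℤ.* a₄ ℤ.+ -[1+ 35 ] ℤ.* a₆ ,
  ℤ-solve 4 (λ x₂ x₃ a₄ a₆ →
      C₆ (Κ (+ 1)) x₂ x₃ a₄ a₆
      , C₆ (Κ (+ 1)) x₂ x₃ (Κ (+ 0)) (Κ (+ 0)) ⊕ ((Κ (+ 3) ⊕ Κ (+ 12) ⊗ x₂) ⊗ a₄ ⊕ Κ -[1+ 35 ] ⊗ a₆) ⊗ Κ (+ 24))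
    refl x₂ x₃ a₄ a₆
  where open ℤᵉ

residue24-periodic : ∀ x₁ κ m → (x₁ ≡ + 0 ⊎ x₁ ≡ + 1) →
  residue24 (scaledC6 x₁ (κ ℤ.+ m ℤ.* + c₆-period x₁)) ≡ residue24 (scaledC6 x₁ κ)
residue24-periodic _ κ m (inj₁ refl) =
  trans (cong residue24 (/-periodic κ m 24 2)) (%-periodic (κ ℤD./ + 2) m 24)
residue24-periodic _ κ m (inj₂ refl) = %-periodic κ m 24

%2-periodic : ∀ x₁ κ m → (x₁ ≡ + 0 ⊎ x₁ ≡ + 1) →
  (κ ℤ.+ m ℤ.* + c₆-period x₁) ℤD.% + 2 ≡ κ ℤD.% + 2
%2-periodic _ κ m (inj₁ refl) =
  trans (cong (λ x → (κ ℤ.+ x) ℤD.% + 2) (sym (ℤP.*-assoc m (+ 24) (+ 2)))) (%-periodic κ (m ℤ.* + 24) 2)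
%2-periodic _ κ m (inj₂ refl) =
  trans (cong (λ x → (κ ℤ.+ x) ℤD.% + 2) (sym (ℤP.*-assoc m (+ 12) (+ 2)))) (%-periodic κ (m ℤ.* + 12) 2)

a₁-parity : ∀ {a1 x₁ c6 κ m} → (a1 ≡ + 0 ⊎ a1 ≡ + 1) → (x₁ ≡ + 0 ⊎ x₁ ≡ + 1) →
  + 2 ∣ (a1 ℤ.- c6) → c6 ≡ κ ℤ.+ m ℤ.* + c₆-period x₁ → + (κ ℤD.% + 2) ≡ x₁ → a1 ≡ x₁
a₁-parity {a1} {x₁} {c6} {κ} {m} a1∈ x₁∈ 2∣a1-c6 c6≡ κ%2≡x₁ = begin
  a1                   ≡⟨ binary a1∈ ⟩
  + (a1 ℤD.% + 2)      ≡⟨ cong +_ (∣⇒%≡ {a1} {c6} 2 2∣a1-c6) ⟩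
  + (c6 ℤD.% + 2)      ≡⟨ cong (λ x → + (x ℤD.% + 2)) c6≡ ⟩
  + ((κ ℤ.+ m ℤ.* + c₆-period x₁) ℤD.% + 2) ≡⟨ cong +_ (%2-periodic x₁ κ m x₁∈) ⟩
  + (κ ℤD.% + 2)       ≡⟨ κ%2≡x₁ ⟩
  x₁                   ∎
  where
  open ≡-Reasoning
  binary : ∀ {a} → (a ≡ + 0 ⊎ a ≡ + 1) → a ≡ + (a ℤD.% + 2)
  binary (inj₁ refl) = refl
  binary (inj₂ refl) = refl

-- The table of the theorem, checked by computation on the shape's constant κ = c₆(a₁,a₂,a₃,0,0).
reducedModel-residue : ∀ i → let (x₁ , x₂ , x₃) = R i ; κ = ℤʷ.C₆ x₁ x₂ x₃ (+ 0) (+ 0) in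
  ResidueIndex (residue24 (scaledC6 x₁ κ)) i × + (κ ℤD.% + 2) ≡ x₁
reducedModel-residue i1  = r0  , refl
reducedModel-residue i2  = r12 , refl
reducedModel-residue i3  = r8  , refl
reducedModel-residue i4  = r20 , refl
reducedModel-residue i5  = r16 , refl
reducedModel-residue i6  = r4  , refl
reducedModel-residue i7  = r23 , refl
reducedModel-residue i8  = r11 , refl
reducedModel-residue i9  = r3  , refl
reducedModel-residue i10 = r15 , refl
reducedModel-residue i11 = r19 , refl
reducedModel-residue i12 = r7  , refl

reducedModel-residueIndex : ∀ i a₄ a₆ {c6 a1} → c₆ (reducedModel i a₄ a₆) ≡ ι c6 →
  (a1 ≡ + 0 ⊎ a1 ≡ + 1) → + 2 ∣ (a1 ℤ.- c6) → ResidueIndex (residue24 (scaledC6 a1 c6)) i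
reducedModel-residueIndex i a₄ a₆ {c6} {a1} c₆≡c6 a1∈ 2∣a1-c6 =
  subst (λ n → ResidueIndex n i) (sym residue≡) (proj₁ (reducedModel-residue i))
  where
  x₁ = proj₁ (R i)
  x₂ = proj₁ (proj₂ (R i))
  x₃ = proj₂ (proj₂ (R i))
  κ = ℤʷ.C₆ x₁ x₂ x₃ (+ 0) (+ 0)
  κ%2≡x₁ = proj₂ (reducedModel-residue i)
  x₁∈ : x₁ ≡ + 0 ⊎ x₁ ≡ + 1
  x₁∈ = subst (λ x → x ≡ + 0 ⊎ x ≡ + 1) κ%2≡x₁ (%2-binary κ)
  m = proj₁ (C₆-periodic x₁ x₂ x₃ a₄ a₆ x₁∈)
  c6≡ : c6 ≡ κ ℤ.+ m ℤ.* + c₆-period x₁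
  c6≡ = trans (ι-injective (trans (sym c₆≡c6) (c₆-integral x₁ x₂ x₃ a₄ a₆)))
              (proj₂ (C₆-periodic x₁ x₂ x₃ a₄ a₆ x₁∈))
  a1≡x₁ : a1 ≡ x₁
  a1≡x₁ = a₁-parity {a1} {x₁} {c6} {κ} {m} a1∈ x₁∈ 2∣a1-c6 c6≡ κ%2≡x₁
  residue≡ : residue24 (scaledC6 a1 c6) ≡ residue24 (scaledC6 x₁ κ)
  residue≡ = begin
    residue24 (scaledC6 a1 c6)                              ≡⟨ cong (λ a → residue24 (scaledC6 a c6)) a1≡x₁ ⟩
    residue24 (scaledC6 x₁ c6)                              ≡⟨ cong (λ c → residue24 (scaledC6 x₁ c)) c6≡ ⟩
    residue24 (scaledC6 x₁ (κ ℤ.+ m ℤ.* + c₆-period x₁)) ≡⟨ residue24-periodic x₁ κ m x₁∈ ⟩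
    residue24 (scaledC6 x₁ κ)                               ∎
    where open ≡-Reasoning

reducedModel-classification : ∀ M {c4 c6 a1} → IsIntegral M → IsReducedForm M →
  c₄ M ≡ ι c4 → c₆ M ≡ ι c6 → (a1 ≡ + 0 ⊎ a1 ≡ + 1) → + 2 ∣ (a1 ℤ.- c6) →
  Σ Idx λ i → ResidueIndex (residue24 (scaledC6 a1 c6)) i × M ≡ model i c4 c6
reducedModel-classification M M-int M-red c₄≡c4 c₆≡c6 a1∈ 2∣a1-c6 with reducedModel-view M M-int M-red
... | i , a₄ , a₆ , refl =
  i , reducedModel-residueIndex i a₄ a₆ c₆≡c6 a1∈ 2∣a1-c6 , reducedModel≡model i a₄ a₆ c₄≡c4 c₆≡c6

ResidueIndex-functional : ∀ {n i j} → ResidueIndex n i → ResidueIndex n j → i ≡ j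
ResidueIndex-functional r0  r0  = refl
ResidueIndex-functional r12 r12 = refl
ResidueIndex-functional r8  r8  = refl
ResidueIndex-functional r20 r20 = refl
ResidueIndex-functional r16 r16 = refl
ResidueIndex-functional r4  r4  = refl
ResidueIndex-functional r23 r23 = refl
ResidueIndex-functional r11 r11 = refl
ResidueIndex-functional r3  r3  = refl
ResidueIndex-functional r15 r15 = refl
ResidueIndex-functional r19 r19 = refl
ResidueIndex-functional r7  r7  = refl

reducedMinimalModel-exists : ∀ E M₀ → IsGlobalMinimal E M₀ →
  Σ Weierstrass λ M → IsReducedMinimalModel E M × c₄ M ≡ c₄ M₀ × c₆ M ≡ c₆ M₀
reducedMinimalModel-exists E M₀ (M₀-int , E≅M₀ , M₀-least) =
  let (r , s , t , M-int , M-red) = reduced-translate M₀ M₀-int in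
  translate r s t M₀ ,
  ( (M-int , ≅-translate {E} {M₀} r s t E≅M₀ , λ M′ M′-int E≅M′ →
        subst (λ d → ∣ d ∣ ≤ ∣ Δ M′ ∣) (sym (Δ-translate r s t M₀)) (M₀-least M′ M′-int E≅M′))
  , M-red) ,
  c₄-translate r s t M₀ , c₆-translate r s t M₀

proposition3p3 : (E : Weierstrass) → IsEllipticCurve E →
    (c4 c6 D : ℤ) → IsMinimalSignature E c4 c6 D →
    (a1 : ℤ) → (a1 ≡ + 0 ⊎ a1 ≡ + 1) → (+ 2 ∣ (a1 ℤ.- c6)) →
    Σ Idx λ i → ResidueIndex (residue24 (scaledC6 a1 c6)) i
      × IsReducedMinimalModel E (model i c4 c6)
      × (∀ M → IsReducedMinimalModel E M → M ≡ model i c4 c6)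
proposition3p3 E ΔE≢0 c4 c6 D (M₀ , M₀-min , c₄M₀ , c₆M₀ , _) a1 a1∈ 2∣a1-c6 =
  let (M , M-reducedMinimal , c₄M≡ , c₆M≡) = reducedMinimalModel-exists E M₀ M₀-min
      (i , residue , M≡model) = classify M M-reducedMinimal c₄M≡ c₆M≡
  in i , residue , subst (IsReducedMinimalModel E) M≡model M-reducedMinimal , unique residue
  where
  classify : ∀ M → IsReducedMinimalModel E M → c₄ M ≡ c₄ M₀ → c₆ M ≡ c₆ M₀ →
    Σ Idx λ i → ResidueIndex (residue24 (scaledC6 a1 c6)) i × M ≡ model i c4 c6
  classify M ((M-int , _) , M-red) c₄M≡ c₆M≡ =
    reducedModel-classification M M-int M-red (trans c₄M≡ c₄M₀) (trans c₆M≡ c₆M₀) a1∈ 2∣a1-c6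
  unique : ∀ {i} → ResidueIndex (residue24 (scaledC6 a1 c6)) i →
    ∀ M′ → IsReducedMinimalModel E M′ → M′ ≡ model i c4 c6
  unique residue M′ M′-reducedMinimal =
    let (c₄M′≡ , c₆M′≡) = globalMinimal⇒c₄≡×c₆≡ E M′ M₀ ΔE≢0 (proj₁ M′-reducedMinimal) M₀-min
        (j , residue′ , M′≡model) = classify M′ M′-reducedMinimal c₄M′≡ c₆M′≡
    in trans M′≡model (cong (λ k → model k c4 c6) (ResidueIndex-functional residue′ residue))
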